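{- Let $S=\{s_1,s_2,s_3,\dots\}$ with $s_n=\left\lfloor (3/2)^n\right\rfloor$ for $n=1,2,3,\dots$. For $\alpha>0$ let $S_\alpha=\{\lfloor \alpha s_1\rfloor,\lfloor \alpha s_2\rfloor,\lfloor \alpha s_3\rfloor,\dots\}$. Then for every real $\alpha$ with $0<\alpha<1$, $\{2^3,2^4\}\not\subseteq S_\alpha$.
   Context: $\lfloor x\rfloor$ denotes the floor (integer part) of a real number $x$. -}

module Defs where

open import Level using (0ℓ)
open import Data.Nat as ℕ using (ℕ; zero; suc; _^_)
open import Data.Nat.DivMod using (_/_)
open import Data.Nat.Properties using (m^n≢0)
open import Data.Integer as ℤ using (ℤ; +_)
open import Data.Product using (Σ; ∃; _×_; _,_)
open import Data.Sum using (_⊎_)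
open import Relation.Nullary using (¬_)
open import Relation.Binary.PropositionalEquality using (_≡_)
open import Relation.Binary.Structures using (IsStrictTotalOrder)
open import Algebra.Structures using (IsCommutativeRing)

-- s n = ⌊ (3/2)^n ⌋ , computed exactly as natural-number floor division 3^n / 2^n.
s : ℕ → ℕ
s n = (3 ^ n) / (2 ^ n)
  where instance _ = m^n≢0 2 n

-- An axiomatisation of the real numbers: a complete (Dedekind/sup-complete)
-- ordered field, equipped with the embedding of ℤ and the floor function.
-- (All models are isomorphic to ℝ, classically.)
record RealNumbers : Set₁ where
  infixl 6 _+_
  infixl 7 _*_
  infix 4 _<_ _≤_
  field
    ℝ    : Set
    _+_  : ℝ → ℝ → ℝ
    _*_  : ℝ → ℝ → ℝ
    -_   : ℝ → ℝ
    0ℝ   : ℝ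
    1ℝ   : ℝ
    _<_  : ℝ → ℝ → Set
    isCommutativeRing : IsCommutativeRing _≡_ _+_ _*_ -_ 0ℝ 1ℝ
    0≢1  : ¬ (0ℝ ≡ 1ℝ)
    inverse : ∀ x → ¬ (x ≡ 0ℝ) → ∃ λ y → x * y ≡ 1ℝ
    isStrictTotalOrder : IsStrictTotalOrder _≡_ _<_
    +-mono-< : ∀ {x y} z → x < y → x + z < y + z
    *-pos    : ∀ {x y} → 0ℝ < x → 0ℝ < y → 0ℝ < x * y

  _≤_ : ℝ → ℝ → Set
  x ≤ y = x < y ⊎ x ≡ y

  field
    sup : (P : ℝ → Set) → ∃ P → (∃ λ b → ∀ x → P x → x ≤ b) →
          ∃ λ u → (∀ x → P x → x ≤ u) × (∀ b → (∀ x → P x → x ≤ b) → u ≤ b)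
    ι     : ℤ → ℝ
    ι-0   : ι (+ 0) ≡ 0ℝ
    ι-suc : ∀ i → ι (i ℤ.+ ℤ.1ℤ) ≡ ι i + 1ℝ
    ⌊_⌋     : ℝ → ℤ
    floor-≤ : ∀ x → ι ⌊ x ⌋ ≤ x
    floor-< : ∀ x → x < ι ⌊ x ⌋ + 1ℝ

_∈S[_] : {R : RealNumbers} → ℤ → RealNumbers.ℝ R → Set
_∈S[_] {R} m α = ∃ λ (n : ℕ) → ⌊ α * ι (+ s (suc n)) ⌋ ≡ m
  where open RealNumbers R

{-# OPTIONS --safe #-}
module Submission where

-- Suppose ⌊α s_m⌋ = 8 and ⌊α s_n⌋ = 16. Comparing the two floors gives
-- 16/9 < s_n / s_m < 17/8, and α < 1 forces s_m ≥ 8. Since s_n ≈ (3/2)^n, the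
-- ratio s_{m+1}/s_m is about 3/2 and s_{m+2}/s_m about 9/4; the floors perturb
-- this only by O(1/s_m), so 9 s_{m+1} ≤ 16 s_m and 17 s_m ≤ 8 s_{m+2}. As s is
-- monotone, no n lands strictly between: n ≤ m+1 and n ≥ m+2 both fail.

open import Defs
open import Level using (0ℓ)
open import Data.Nat as ℕ using (zero; suc)
import Data.Nat.Properties as ℕ
open import Data.Integer using (+_)
open import Data.Product using (_×_; _,_)
open import Data.Sum using (inj₁; inj₂)
open import Data.Empty using (⊥; ⊥-elim)
open import Relation.Nullary using (¬_; yes; no)
open import Relation.Binary.PropositionalEquality
open import Relation.Binary.Structures using (IsStrictTotalOrder)
open import Relation.Binary.Bundles using (StrictPartialOrder)
open import Relation.Binary.Definitions using (tri<; tri≈; tri>)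
open import Algebra.Structures using (IsCommutativeRing)
open import Algebra.Bundles using (CommutativeRing)

module s-Properties where
  open import Data.Nat
  open import Data.Nat.Properties
  open import Data.Nat.DivMod using (m/n*n≤m; m%n<n; m≡m%n+[m/n]*n)
  open import Data.Nat.Tactic.RingSolver using (solve-∀)
  open import Algebra.Properties.CommutativeSemigroup *-commutativeSemigroup
    using (xy∙z≈y∙xz; x∙yz≈y∙xz)
  open ≤-Reasoning

  s[k]*2^k≤3^k : ∀ k → s k * 2 ^ k ≤ 3 ^ k
  s[k]*2^k≤3^k k = m/n*n≤m (3 ^ k) (2 ^ k) {{m^n≢0 2 k}}

  3^k<[1+s[k]]*2^k : ∀ k → 3 ^ k < suc (s k) * 2 ^ k
  3^k<[1+s[k]]*2^k k = begin-strict
    3 ^ k                            ≡⟨ m≡m%n+[m/n]*n (3 ^ k) (2 ^ k) ⟩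
    3 ^ k % 2 ^ k + s k * 2 ^ k      <⟨ +-monoˡ-< (s k * 2 ^ k) (m%n<n (3 ^ k) (2 ^ k)) ⟩
    2 ^ k + s k * 2 ^ k              ∎
    where instance _ = m^n≢0 2 k

  3^j*s[k]<2^j*[1+s[j+k]] : ∀ j k → 3 ^ j * s k < 2 ^ j * suc (s (j + k))
  3^j*s[k]<2^j*[1+s[j+k]] j k = *-cancelʳ-< (2 ^ k) _ _ (begin-strict
    3 ^ j * s k * 2 ^ k              ≡⟨ *-assoc (3 ^ j) (s k) (2 ^ k) ⟩
    3 ^ j * (s k * 2 ^ k)            ≤⟨ *-monoʳ-≤ (3 ^ j) (s[k]*2^k≤3^k k) ⟩
    3 ^ j * 3 ^ k                    ≡⟨ ^-distribˡ-+-* 3 j k ⟨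
    3 ^ (j + k)                      <⟨ 3^k<[1+s[k]]*2^k (j + k) ⟩
    suc (s (j + k)) * 2 ^ (j + k)    ≡⟨ cong (suc (s (j + k)) *_) (^-distribˡ-+-* 2 j k) ⟩
    suc (s (j + k)) * (2 ^ j * 2 ^ k) ≡⟨ xy∙z≈y∙xz (2 ^ j) (suc (s (j + k))) (2 ^ k) ⟨
    2 ^ j * suc (s (j + k)) * 2 ^ k  ∎)

  2^j*s[j+k]<3^j*[1+s[k]] : ∀ j k → 2 ^ j * s (j + k) < 3 ^ j * suc (s k)
  2^j*s[j+k]<3^j*[1+s[k]] j k = *-cancelʳ-< (2 ^ k) _ _ (begin-strict
    2 ^ j * s (j + k) * 2 ^ k        ≡⟨ xy∙z≈y∙xz (2 ^ j) (s (j + k)) (2 ^ k) ⟩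
    s (j + k) * (2 ^ j * 2 ^ k)      ≡⟨ cong (s (j + k) *_) (^-distribˡ-+-* 2 j k) ⟨
    s (j + k) * 2 ^ (j + k)          ≤⟨ s[k]*2^k≤3^k (j + k) ⟩
    3 ^ (j + k)                      ≡⟨ ^-distribˡ-+-* 3 j k ⟩
    3 ^ j * 3 ^ k                    <⟨ *-monoʳ-< (3 ^ j) (3^k<[1+s[k]]*2^k k) ⟩
    3 ^ j * (suc (s k) * 2 ^ k)      ≡⟨ *-assoc (3 ^ j) (suc (s k)) (2 ^ k) ⟨
    3 ^ j * suc (s k) * 2 ^ k        ∎)
    where instance _ = m^n≢0 3 j

  s-mono-suc : ∀ k → s k ≤ s (suc k)
  s-mono-suc k = ≮⇒≥ λ sₖ₊₁<sₖ → <-irrefl refl (begin-strict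
    3 * s k                  <⟨ 3^j*s[k]<2^j*[1+s[j+k]] 1 k ⟩
    2 * suc (s (suc k))      ≤⟨ *-monoʳ-≤ 2 sₖ₊₁<sₖ ⟩
    2 * s k                  ≤⟨ *-monoˡ-≤ (s k) (n≤1+n 2) ⟩
    3 * s k                  ∎)

  s-mono : ∀ {k l} → k ≤ l → s k ≤ s l
  s-mono {l = zero} z≤n = ≤-refl
  s-mono {l = suc l} k≤1+l with m≤n⇒m<n∨m≡n k≤1+l
  ... | inj₁ k<1+l = ≤-trans (s-mono (s≤s⁻¹ k<1+l)) (s-mono-suc l)
  ... | inj₂ refl  = ≤-refl

  9*s[1+k]≤16*s[k] : ∀ k → 6 ≤ s k → 9 * s (suc k) ≤ 16 * s k
  9*s[1+k]≤16*s[k] k 6≤sₖ = *-cancelˡ-≤ 2 (begin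
    2 * (9 * s (suc k))      ≡⟨ x∙yz≈y∙xz 2 9 (s (suc k)) ⟩
    9 * (2 * s (suc k))      ≤⟨ *-monoʳ-≤ 9 (<⇒≤ (2^j*s[j+k]<3^j*[1+s[k]] 1 k)) ⟩
    9 * (3 * suc (s k))      ≡⟨ expand (s k) ⟩
    27 * s k + 27            ≤⟨ +-monoʳ-≤ (27 * s k) (≤-trans (m≤m+n 27 3) (*-monoʳ-≤ 5 6≤sₖ)) ⟩
    27 * s k + 5 * s k       ≡⟨ collect (s k) ⟩
    2 * (16 * s k)           ∎)
    where
    expand : ∀ a → 9 * (3 * suc a) ≡ 27 * a + 27
    expand = solve-∀
    collect : ∀ a → 27 * a + 5 * a ≡ 2 * (16 * a)
    collect = solve-∀

  17*s[k]≤8*s[2+k] : ∀ k → 6 ≤ s k → 17 * s k ≤ 8 * s (2 + k)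
  17*s[k]≤8*s[2+k] k 6≤sₖ = +-cancelʳ-≤ 8 _ _ (begin
    17 * s k + 8             ≡⟨ +-assoc (17 * s k) 6 2 ⟨
    17 * s k + 6 + 2         ≤⟨ +-monoˡ-≤ 2 (+-monoʳ-≤ (17 * s k) 6≤sₖ) ⟩
    17 * s k + s k + 2       ≡⟨ collect (s k) ⟩
    2 * suc (9 * s k)        ≤⟨ *-monoʳ-≤ 2 (3^j*s[k]<2^j*[1+s[j+k]] 2 k) ⟩
    2 * (4 * suc (s (2 + k))) ≡⟨ expand (s (2 + k)) ⟩
    8 * s (2 + k) + 8        ∎)
    where
    collect : ∀ a → 17 * a + a + 2 ≡ 2 * suc (9 * a)
    collect = solve-∀
    expand : ∀ a → 2 * (4 * suc a) ≡ 8 * a + 8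
    expand = solve-∀

  s-ratio∉⟨16/9,17/8⟩ : ∀ m n → 6 ≤ s m → 16 * s m < 9 * s n → 8 * s n < 17 * s m → ⊥
  s-ratio∉⟨16/9,17/8⟩ m n 6≤sₘ 16sₘ<9sₙ 8sₙ<17sₘ with n ≤? suc m
  ... | yes n≤1+m = <-irrefl refl (begin-strict
    16 * s m                 <⟨ 16sₘ<9sₙ ⟩
    9 * s n                  ≤⟨ *-monoʳ-≤ 9 (s-mono n≤1+m) ⟩
    9 * s (suc m)            ≤⟨ 9*s[1+k]≤16*s[k] m 6≤sₘ ⟩
    16 * s m                 ∎)
  ... | no n≰1+m = <-irrefl refl (begin-strict
    8 * s n                  <⟨ 8sₙ<17sₘ ⟩
    17 * s m                 ≤⟨ 17*s[k]≤8*s[2+k] m 6≤sₘ ⟩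
    8 * s (2 + m)            ≤⟨ *-monoʳ-≤ 8 (s-mono (≰⇒> n≰1+m)) ⟩
    8 * s n                  ∎)

module RealNumbersProperties (R : RealNumbers) where
  open RealNumbers R
  open IsCommutativeRing isCommutativeRing
    using (+-comm; +-identityˡ; *-identityˡ; -‿inverseʳ; distribʳ; zeroʳ)
  open IsStrictTotalOrder isStrictTotalOrder
    using (compare; isStrictPartialOrder) renaming (trans to <-trans; irrefl to <-irrefl′)

  commutativeRing : CommutativeRing 0ℓ 0ℓ
  commutativeRing = record { isCommutativeRing = isCommutativeRing }

  open CommutativeRing commutativeRing using (ring; semiring; +-group; *-commutativeSemigroup)
  open import Algebra.Properties.Ring ring using (-1*x≈-x; -‿involutive; -‿distribˡ-*)
  open import Algebra.Properties.Group +-group using (//-rightDividesˡ)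
  open import Algebra.Properties.CommutativeSemigroup *-commutativeSemigroup using (xy∙z≈xz∙y)
  open import Algebra.Properties.Semiring.Mult semiring using (×1-homo-*) renaming (_×_ to _×ᵣ_)

  strictPartialOrder : StrictPartialOrder 0ℓ 0ℓ 0ℓ
  strictPartialOrder = record { isStrictPartialOrder = isStrictPartialOrder }

  open import Relation.Binary.Reasoning.StrictPartialOrder strictPartialOrder

  <-irrefl : ∀ {x} → x < x → ⊥
  <-irrefl = <-irrefl′ refl

  0<1 : 0ℝ < 1ℝ
  0<1 with compare 0ℝ 1ℝ
  ... | tri< 0<1′ _ _ = 0<1′
  ... | tri≈ _ 0≡1 _ = ⊥-elim (0≢1 0≡1)
  ... | tri> _ _ 1<0 = ⊥-elim (<-irrefl (<-trans 1<0 0<[-1]*[-1]))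
    where
    0<-1 : 0ℝ < - 1ℝ
    0<-1 = subst₂ _<_ (-‿inverseʳ 1ℝ) (+-identityˡ (- 1ℝ)) (+-mono-< (- 1ℝ) 1<0)
    0<[-1]*[-1] : 0ℝ < 1ℝ
    0<[-1]*[-1] = subst (0ℝ <_) (trans (-1*x≈-x (- 1ℝ)) (-‿involutive 1ℝ)) (*-pos 0<-1 0<-1)

  *-monoˡ-< : ∀ {x y z} → 0ℝ < z → x < y → x * z < y * z
  *-monoˡ-< {x} {y} {z} 0<z x<y =
    subst₂ _<_ (+-identityˡ (x * z)) [y-x]z+xz≡yz (+-mono-< (x * z) (*-pos 0<y-x 0<z))
    where
    0<y-x : 0ℝ < y + - x
    0<y-x = subst (_< y + - x) (-‿inverseʳ x) (+-mono-< (- x) x<y)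
    [y-x]z+xz≡yz : (y + - x) * z + x * z ≡ y * z
    [y-x]z+xz≡yz = begin-equality
      (y + - x) * z + x * z      ≡⟨ cong (_+ x * z) (distribʳ z y (- x)) ⟩
      y * z + - x * z + x * z    ≡⟨ cong (λ w → y * z + w + x * z) (-‿distribˡ-* x z) ⟨
      y * z + - (x * z) + x * z  ≡⟨ //-rightDividesˡ (x * z) (y * z) ⟩
      y * z                      ∎

  *-monoˡ-≤ : ∀ {x y z} → 0ℝ ≤ z → x ≤ y → x * z ≤ y * z
  *-monoˡ-≤ (inj₁ 0<z)  (inj₁ x<y) = inj₁ (*-monoˡ-< 0<z x<y)
  *-monoˡ-≤ (inj₂ refl) (inj₁ _)   = inj₂ (trans (zeroʳ _) (sym (zeroʳ _)))
  *-monoˡ-≤ _           (inj₂ refl) = inj₂ refl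

  ι-suc-ℕ : ∀ n → ι (+ suc n) ≡ ι (+ n) + 1ℝ
  ι-suc-ℕ n = subst (λ m → ι (+ m) ≡ ι (+ n) + 1ℝ) (ℕ.+-comm n 1) (ι-suc (+ n))

  ι-ℕ-≡-×1 : ∀ n → ι (+ n) ≡ n ×ᵣ 1ℝ
  ι-ℕ-≡-×1 zero    = ι-0
  ι-ℕ-≡-×1 (suc n) = begin-equality
    ι (+ suc n)          ≡⟨ ι-suc-ℕ n ⟩
    ι (+ n) + 1ℝ         ≡⟨ +-comm (ι (+ n)) 1ℝ ⟩
    1ℝ + ι (+ n)         ≡⟨ cong (λ w → 1ℝ + w) (ι-ℕ-≡-×1 n) ⟩
    1ℝ + n ×ᵣ 1ℝ         ∎

  ι-homo-* : ∀ m n → ι (+ (m ℕ.* n)) ≡ ι (+ m) * ι (+ n)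
  ι-homo-* m n = begin-equality
    ι (+ (m ℕ.* n))          ≡⟨ ι-ℕ-≡-×1 (m ℕ.* n) ⟩
    (m ℕ.* n) ×ᵣ 1ℝ          ≡⟨ ×1-homo-* m n ⟩
    m ×ᵣ 1ℝ * n ×ᵣ 1ℝ        ≡⟨ cong₂ _*_ (ι-ℕ-≡-×1 m) (ι-ℕ-≡-×1 n) ⟨
    ι (+ m) * ι (+ n)        ∎

  ι-<-suc : ∀ n → ι (+ n) < ι (+ suc n)
  ι-<-suc n = subst₂ _<_ (+-identityˡ (ι (+ n))) (trans (+-comm 1ℝ (ι (+ n))) (sym (ι-suc-ℕ n)))
                (+-mono-< (ι (+ n)) 0<1)

  ι-mono-< : ∀ {m n} → m ℕ.< n → ι (+ m) < ι (+ n)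
  ι-mono-< {m} {suc n} m<1+n with ℕ.m≤n⇒m<n∨m≡n (ℕ.s≤s⁻¹ m<1+n)
  ... | inj₁ m<n  = <-trans (ι-mono-< m<n) (ι-<-suc n)
  ... | inj₂ refl = ι-<-suc n

  ι-mono-≤ : ∀ {m n} → m ℕ.≤ n → ι (+ m) ≤ ι (+ n)
  ι-mono-≤ m≤n with ℕ.m≤n⇒m<n∨m≡n m≤n
  ... | inj₁ m<n  = inj₁ (ι-mono-< m<n)
  ... | inj₂ refl = inj₂ refl

  ι-nonneg : ∀ n → 0ℝ ≤ ι (+ n)
  ι-nonneg n = subst (_≤ ι (+ n)) ι-0 (ι-mono-≤ ℕ.z≤n)

  ι-pos : ∀ {n} → 0 ℕ.< n → 0ℝ < ι (+ n)
  ι-pos 0<n = subst (_< ι (+ _)) ι-0 (ι-mono-< 0<n)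

  ι-cancel-< : ∀ {m n} → ι (+ m) < ι (+ n) → m ℕ.< n
  ι-cancel-< {m} {n} ιm<ιn = ℕ.≰⇒> λ n≤m → <-irrefl (begin-strict
    ι (+ m)  <⟨ ιm<ιn ⟩
    ι (+ n)  ≤⟨ ι-mono-≤ n≤m ⟩
    ι (+ m)  ∎)

  ι-cancel-≤ : ∀ {m n} → ι (+ m) ≤ ι (+ n) → m ℕ.≤ n
  ι-cancel-≤ {m} {n} ιm≤ιn = ℕ.s≤s⁻¹ (ι-cancel-< (begin-strict
    ι (+ m)      ≤⟨ ιm≤ιn ⟩
    ι (+ n)      <⟨ ι-<-suc n ⟩
    ι (+ suc n)  ∎))

  floor≡⇒≤ : ∀ {x k} → ⌊ x ⌋ ≡ + k → ι (+ k) ≤ x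
  floor≡⇒≤ {x} ⌊x⌋≡k = subst (λ i → ι i ≤ x) ⌊x⌋≡k (floor-≤ x)

  floor≡⇒< : ∀ {x k} → ⌊ x ⌋ ≡ + k → x < ι (+ suc k)
  floor≡⇒< {x} {k} ⌊x⌋≡k =
    subst (x <_) (sym (ι-suc-ℕ k)) (subst (λ i → x < ι i + 1ℝ) ⌊x⌋≡k (floor-< x))

  floor-scaled-≤ : ∀ {α N k} → α < 1ℝ → ⌊ α * ι (+ N) ⌋ ≡ + k → k ℕ.≤ N
  floor-scaled-≤ {α} {N} {k} α<1 ⌊αN⌋≡k = ι-cancel-≤ (begin
    ι (+ k)        ≤⟨ floor≡⇒≤ ⌊αN⌋≡k ⟩
    α * ι (+ N)    ≤⟨ *-monoˡ-≤ (ι-nonneg N) (inj₁ α<1) ⟩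
    1ℝ * ι (+ N)   ≡⟨ *-identityˡ (ι (+ N)) ⟩
    ι (+ N)        ∎)

  floor-scaled-ratio : ∀ {α P Q a b} → 0ℝ < ι (+ P) →
    ⌊ α * ι (+ P) ⌋ ≡ + a → ⌊ α * ι (+ Q) ⌋ ≡ + b → a ℕ.* Q ℕ.< suc b ℕ.* P
  floor-scaled-ratio {α} {P} {Q} {a} {b} 0<p ⌊αP⌋≡a ⌊αQ⌋≡b = ι-cancel-< (begin-strict
    ι (+ (a ℕ.* Q))              ≡⟨ ι-homo-* a Q ⟩
    ι (+ a) * ι (+ Q)            ≤⟨ *-monoˡ-≤ (ι-nonneg Q) (floor≡⇒≤ ⌊αP⌋≡a) ⟩
    α * ι (+ P) * ι (+ Q)        ≡⟨ xy∙z≈xz∙y α (ι (+ P)) (ι (+ Q)) ⟩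
    α * ι (+ Q) * ι (+ P)        <⟨ *-monoˡ-< 0<p (floor≡⇒< ⌊αQ⌋≡b) ⟩
    ι (+ suc b) * ι (+ P)        ≡⟨ ι-homo-* (suc b) P ⟨
    ι (+ (suc b ℕ.* P))          ∎)

open s-Properties using (s-ratio∉⟨16/9,17/8⟩)

theorem2p1 : (R : RealNumbers) → (α : RealNumbers.ℝ R) →
    RealNumbers._<_ R (RealNumbers.0ℝ R) α → RealNumbers._<_ R α (RealNumbers.1ℝ R) →
    ¬ (_∈S[_] {R} (+ 8) α × _∈S[_] {R} (+ 16) α)
theorem2p1 R α _ α<1 ((m , ⌊αsₘ⌋≡8) , (n , ⌊αsₙ⌋≡16)) =
  s-ratio∉⟨16/9,17/8⟩ (suc m) (suc n) 6≤sₘ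
    (floor-scaled-ratio (ι-pos (ℕ.<-≤-trans ℕ.z<s 16≤sₙ)) ⌊αsₙ⌋≡16 ⌊αsₘ⌋≡8)
    (floor-scaled-ratio (ι-pos (ℕ.<-≤-trans ℕ.z<s 8≤sₘ)) ⌊αsₘ⌋≡8 ⌊αsₙ⌋≡16)
  where
  open RealNumbersProperties R
  8≤sₘ : 8 ℕ.≤ s (suc m)
  8≤sₘ = floor-scaled-≤ α<1 ⌊αsₘ⌋≡8
  16≤sₙ : 16 ℕ.≤ s (suc n)
  16≤sₙ = floor-scaled-≤ α<1 ⌊αsₙ⌋≡16
  6≤sₘ : 6 ℕ.≤ s (suc m)
  6≤sₘ = ℕ.≤-trans (ℕ.m≤m+n 6 2) 8≤sₘ
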